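{- If $G$ and $H$ are graphs such that $G$ is $\omega(I(H))$-colorable, then $\iota(G\,\Box\, H)\le n(G)\iota(H)$.
   Context: All graphs are finite and simple; $n(G)=|V(G)|$, $\Box$ is the Cartesian product, $\omega$ the clique number. $A\subseteq V(G)$ is an isolating set if $V(G)-N[A]$ is independent ($N[A]$ the closed neighborhood); $\iota(G)$ is the minimum size of an isolating set, and an $\iota(G)$-set is one of that size. For an $\iota(H)$-set $A$, $L_A=V(H)-N[A]$. The isolation graph $I(H)$ has the $\iota(H)$-sets as vertices, distinct $A,B$ adjacent whenever $L_A\cap L_B=\emptyset$. -}

module Defs where

open import Data.Nat using (ℕ; _≤_; _*_)
open import Data.Fin using (Fin; remQuot)
open import Data.Fin.Subset using (Subset; _∈_; _∉_; ∣_∣)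
open import Data.Product using (Σ; ∃; _×_; _,_; proj₁; proj₂)
open import Data.Sum using (_⊎_; inj₁; inj₂)
open import Data.Empty using (⊥)
open import Relation.Nullary using (¬_)
open import Relation.Binary.PropositionalEquality using (_≡_; refl; sym)
open import Function.Definitions using (Injective)

record Graph : Set₁ where
  field
    n      : ℕ
    Adj    : Fin n → Fin n → Set
    adj-sym    : ∀ {u v} → Adj u v → Adj v u
    adj-irrefl : ∀ {v} → ¬ Adj v v
open Graph public

_□_ : Graph → Graph → Graph
G □ H = record
  { n = n G * n H
  ; Adj = λ x y → PAdj (remQuot (n H) x) (remQuot (n H) y)
  ; adj-sym = psym
  ; adj-irrefl = pirr
  }
  where
  PAdj : Fin (n G) × Fin (n H) → Fin (n G) × Fin (n H) → Set
  PAdj (g , h) (g' , h') = (g ≡ g' × Adj H h h') ⊎ (Adj G g g' × h ≡ h')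
  psym : ∀ {p q} → PAdj p q → PAdj q p
  psym (inj₁ (e , a)) = inj₁ (sym e , Graph.adj-sym H a)
  psym (inj₂ (a , e)) = inj₂ (Graph.adj-sym G a , sym e)
  pirr : ∀ {p} → ¬ PAdj p p
  pirr (inj₁ (_ , a)) = Graph.adj-irrefl H a
  pirr (inj₂ (a , _)) = Graph.adj-irrefl G a

module _ (G : Graph) where

  InClosedNbhd : Subset (n G) → Fin (n G) → Set
  InClosedNbhd A v = ∃ λ a → a ∈ A × (a ≡ v ⊎ Adj G a v)

  Isolating : Subset (n G) → Set
  Isolating A = ∀ u v → ¬ InClosedNbhd A u → ¬ InClosedNbhd A v → ¬ Adj G u v

  IsIota : ℕ → Set
  IsIota k = (∃ λ A → Isolating A × ∣ A ∣ ≡ k) × (∀ A → Isolating A → k ≤ ∣ A ∣)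

  IotaSet : ℕ → Subset (n G) → Set
  IotaSet k A = Isolating A × ∣ A ∣ ≡ k

  InL : Subset (n G) → Fin (n G) → Set
  InL A v = ¬ InClosedNbhd A v

  -- A clique of size w in the isolation graph I(G) (where ι(G) = k):
  -- w distinct ι(G)-sets, pairwise with disjoint L-sets.
  IsolationClique : ℕ → ℕ → Set
  IsolationClique k w =
    Σ (Fin w → Subset (n G)) λ f →
      Injective _≡_ _≡_ f
      × (∀ i → IotaSet k (f i))
      × (∀ i j → ¬ i ≡ j → ∀ v → InL (f i) v → InL (f j) v → ⊥)

  IsIsolationCliqueNumber : ℕ → ℕ → Set
  IsIsolationCliqueNumber k w =
    IsolationClique k w × (∀ w' → IsolationClique k w' → w' ≤ w)

  Colorable : ℕ → Set
  Colorable c = ∃ λ (col : Fin (n G) → Fin c) → ∀ u v → Adj G u v → ¬ col u ≡ col v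

-- Fix a proper w-colouring c of G and a clique A₀, …, A_{w-1} of ι(H)-sets in I(H).
-- The set whose fibre over g ∈ V(G) is A_{c(g)} has n(G)·ι(H) vertices and isolates G □ H:
-- two vertices outside its closed neighbourhood that are adjacent within an H-fibre would
-- form an edge of L_{A_{c(g)}}, and two that are adjacent along a G-edge gg' would lie in
-- the disjoint sets L_{A_{c(g)}} and L_{A_{c(g')}}, with c(g) ≠ c(g').
module Submission where

open import Defs
open import Data.Nat using (ℕ; _≤_; _*_; _+_; suc; zero)
open import Data.Nat.Properties using (≤-trans; ≤-reflexive)
open import Data.Bool using (true; false)
open import Data.Fin using (Fin; remQuot; combine)
open import Data.Fin.Properties using (remQuot-combine; combine-remQuot)
open import Data.Fin.Subset using (Subset; _∈_; ∣_∣)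
open import Data.Vec using ([]; _∷_; _++_; concat; tabulate; lookup)
open import Data.Vec.Properties using (lookup-concat; lookup∘tabulate; []=⇒lookup; lookup⇒[]=)
open import Data.Product using (_×_; _,_; proj₁; proj₂)
open import Data.Sum using (_⊎_; inj₁; inj₂)
open import Data.Empty using (⊥)
open import Relation.Nullary using (¬_)
open import Relation.Binary.PropositionalEquality
  using (_≡_; refl; sym; cong; subst; subst₂; module ≡-Reasoning)

∣p++q∣≡∣p∣+∣q∣ : ∀ {a b} (p : Subset a) (q : Subset b) → ∣ p ++ q ∣ ≡ ∣ p ∣ + ∣ q ∣
∣p++q∣≡∣p∣+∣q∣ []          q = refl
∣p++q∣≡∣p∣+∣q∣ (true ∷ p)  q = cong suc (∣p++q∣≡∣p∣+∣q∣ p q)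
∣p++q∣≡∣p∣+∣q∣ (false ∷ p) q = ∣p++q∣≡∣p∣+∣q∣ p q

∣concat∣-constant : ∀ {m} n k (F : Fin n → Subset m) → (∀ i → ∣ F i ∣ ≡ k) →
                    ∣ concat (tabulate F) ∣ ≡ n * k
∣concat∣-constant zero    k F ∣F∣≡k = refl
∣concat∣-constant (suc n) k F ∣F∣≡k = begin
  ∣ F Fin.zero ++ concat (tabulate F⁺) ∣
    ≡⟨ ∣p++q∣≡∣p∣+∣q∣ (F Fin.zero) _ ⟩
  ∣ F Fin.zero ∣ + ∣ concat (tabulate F⁺) ∣
    ≡⟨ cong (_+ ∣ concat (tabulate F⁺) ∣) (∣F∣≡k Fin.zero) ⟩
  k + ∣ concat (tabulate F⁺) ∣
    ≡⟨ cong (k +_) (∣concat∣-constant n k F⁺ (λ i → ∣F∣≡k (Fin.suc i))) ⟩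
  k + n * k
    ∎
  where
  open ≡-Reasoning
  F⁺ : Fin n → Subset _
  F⁺ i = F (Fin.suc i)

module _ (G H : Graph) where

  -- Adj (G □ H) u v unfolds to ProductAdj (remQuot u) (remQuot v).
  ProductAdj : Fin (n G) × Fin (n H) → Fin (n G) × Fin (n H) → Set
  ProductAdj p q = (proj₁ p ≡ proj₁ q × Adj H (proj₂ p) (proj₂ q))
                 ⊎ (Adj G (proj₁ p) (proj₁ q) × proj₂ p ≡ proj₂ q)

  □-adjacent-in-fibre : ∀ g {h h'} → Adj H h h' → Adj (G □ H) (combine g h) (combine g h')
  □-adjacent-in-fibre g {h} {h'} hh' =
    subst₂ ProductAdj (sym (remQuot-combine g h)) (sym (remQuot-combine g h')) (inj₁ (refl , hh'))

  module _ (F : Fin (n G) → Subset (n H)) where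

    fibreUnion : Subset (n (G □ H))
    fibreUnion = concat (tabulate F)

    ∈-fibreUnion : ∀ {g h} → h ∈ F g → combine g h ∈ fibreUnion
    ∈-fibreUnion {g} {h} h∈Fg = lookup⇒[]= (combine g h) fibreUnion (begin
      lookup fibreUnion (combine g h)  ≡⟨ lookup-concat (tabulate F) g h ⟩
      lookup (lookup (tabulate F) g) h ≡⟨ cong (λ p → lookup p h) (lookup∘tabulate F g) ⟩
      lookup (F g) h                   ≡⟨ []=⇒lookup h∈Fg ⟩
      true                             ∎)
      where open ≡-Reasoning

    closedNbhd-fibreUnion : ∀ {g h} → InClosedNbhd H (F g) h →
                            InClosedNbhd (G □ H) fibreUnion (combine g h)
    closedNbhd-fibreUnion {g} (a , a∈Fg , inj₁ a≡h) =
      combine g a , ∈-fibreUnion a∈Fg , inj₁ (cong (combine g) a≡h)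
    closedNbhd-fibreUnion {g} (a , a∈Fg , inj₂ ah) =
      combine g a , ∈-fibreUnion a∈Fg , inj₂ (□-adjacent-in-fibre g ah)

    L-fibreUnion : ∀ u → InL (G □ H) fibreUnion u →
                   InL H (F (proj₁ (remQuot {n G} (n H) u))) (proj₂ (remQuot {n G} (n H) u))
    L-fibreUnion u u∈L h∈N = u∈L (subst (InClosedNbhd (G □ H) fibreUnion)
                                       (combine-remQuot {n G} (n H) u)
                                       (closedNbhd-fibreUnion h∈N))

    fibreUnion-isolating :
      (∀ g → Isolating H (F g)) →
      (∀ g g' → Adj G g g' → ∀ h → InL H (F g) h → InL H (F g') h → ⊥) →
      Isolating (G □ H) fibreUnion
    fibreUnion-isolating isolating disjoint u v u∈L v∈L =
      independent (remQuot {n G} (n H) u) (remQuot {n G} (n H) v)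
                  (L-fibreUnion u u∈L) (L-fibreUnion v v∈L)
      where
      independent : ∀ p q → InL H (F (proj₁ p)) (proj₂ p) → InL H (F (proj₁ q)) (proj₂ q) →
                    ¬ ProductAdj p q
      independent (g , h) (.g , h') h∈L h'∈L (inj₁ (refl , hh')) = isolating g h h' h∈L h'∈L hh'
      independent (g , h) (g' , .h) h∈L h∈L' (inj₂ (gg' , refl)) = disjoint g g' gg' h h∈L h∈L'

corollary3p4 : (G H : Graph) (k w : ℕ) →
    IsIota H k → IsIsolationCliqueNumber H k w → Colorable G w →
    ∀ m → IsIota (G □ H) m → m ≤ n G * k
corollary3p4 G H k w _ ((A , _ , A-ιsets , A-disjoint) , _) (c , c-proper) m (_ , m-minimum) =
  ≤-trans (m-minimum (fibreUnion G H F) isolating) (≤-reflexive size)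
  where
  F : Fin (n G) → Subset (n H)
  F g = A (c g)

  isolating : Isolating (G □ H) (fibreUnion G H F)
  isolating = fibreUnion-isolating G H F (λ g → proj₁ (A-ιsets (c g)))
                (λ g g' gg' → A-disjoint (c g) (c g') (c-proper g g' gg'))

  size : ∣ fibreUnion G H F ∣ ≡ n G * k
  size = ∣concat∣-constant (n G) k F (λ g → proj₂ (A-ιsets (c g)))
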